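{- Let $m,n$ be integers with $n\ge3$ and $m-n\ge1$, and let $G$, $P$ and the matching $\mu:S\to P\setminus S$ be as in the context. If $\sigma\in P$ is a critical cell with $N(\sigma)=\{\langle1\rangle\}$, then $\sigma=\{\langle2\rangle,\langle3\rangle,\dots,\langle m\rangle\}$.
   Context: $[k]=\{1,\dots,k\}$. Let $G$ be the graph whose vertices are the maps $f:[n]\to[m]$ that are either constant or injective, with $f\sim f'$ iff $f(i)\ne f'(j)$ for all $i\ne j$ in $[n]$ (injective maps have loops). The constant map with value $x$ is denoted $\langle x\rangle$. For a set $A$ of vertices, $N(A)$ is the set of common neighbours of $A$. The neighbourhood complex $\mathcal N(G)$ has as simplices the nonempty vertex sets with a common neighbour; $P$ is its set of simplices ordered by inclusion. Define $S_1=\{\sigma\in P:\langle 1\rangle\notin\sigma,\ \sigma\cup\{\langle1\rangle\}\in P\}$, $\mu_1(\sigma)=\sigma\cup\{\langle1\rangle\}$, $S_1'=P\setminus(S_1\cup\mu_1(S_1))$, and for $2\le i\le m$ inductively $S_i=\{\sigma\in S_{i-1}':\langle i\rangle\notin\sigma,\ \sigma\cup\{\langle i\rangle\}\in S'_{i-1}\}$, $\mu_i(\sigma)=\sigma\cup\{\langle i\rangle\}$, $S_i'=S_{i-1}'\setminus(S_i\cup\mu_i(S_i))$. Let $S=\bigcup_i S_i$ and $\mu(\sigma)=\mu_i(\sigma)$ for $\sigma\in S_i$. A simplex $\sigma\in P$ is critical if $\sigma\notin S\cup\mu(S)$. -}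

module Defs where

open import Data.Nat using (ℕ; zero; suc; _≤_; _<_)
open import Data.Nat.Properties using (<⇒≤)
open import Data.Fin using (Fin; toℕ; fromℕ<)
open import Data.Fin.Properties using (toℕ<n)
import Data.Fin.Properties as FinP
open import Data.Vec using (Vec; lookup; replicate)
open import Data.Vec.Properties using (≡-dec)
open import Data.Bool using (Bool; true; false; _∨_)
open import Data.Product using (Σ; ∃; _×_; _,_)
open import Data.Sum using (_⊎_)
open import Relation.Nullary using (¬_)
open import Relation.Nullary.Decidable using (⌊_⌋)
open import Relation.Binary.PropositionalEquality using (_≡_; _≢_)

-- Conventions: [k] is modelled by Fin k, with the element i+1 of [k]
-- represented by the Fin-value of toℕ = i (so ⟨1⟩ is the constant map at
-- the Fin-element with toℕ 0).

Map : ℕ → ℕ → Set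
Map n m = Vec (Fin m) n

IsVertex : ∀ {n m} → Map n m → Set
IsVertex f = (∀ i j → lookup f i ≡ lookup f j)
           ⊎ (∀ i j → lookup f i ≡ lookup f j → i ≡ j)

⟨_⟩ : ∀ {n m} → Fin m → Map n m
⟨ x ⟩ = replicate _ x

Adj : ∀ {n m} → Map n m → Map n m → Set
Adj f g = ∀ i j → i ≢ j → lookup f i ≢ lookup g j

VSet : ℕ → ℕ → Set
VSet n m = Map n m → Bool

_∈_ : ∀ {n m} → Map n m → VSet n m → Set
f ∈ σ = σ f ≡ true

_≐_ : ∀ {n m} → VSet n m → VSet n m → Set
σ ≐ τ = ∀ f → σ f ≡ τ f

_∪｛_｝ : ∀ {n m} → VSet n m → Map n m → VSet n m
(σ ∪｛ c ｝) f = σ f ∨ ⌊ ≡-dec FinP._≟_ f c ⌋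

IsCommonNbr : ∀ {n m} → VSet n m → Map n m → Set
IsCommonNbr σ g = IsVertex g × (∀ f → f ∈ σ → Adj f g)

-- simplices of the neighbourhood complex: nonempty sets of vertices with a
-- common neighbour
InP : ∀ {n m} → VSet n m → Set
InP σ = (∀ f → f ∈ σ → IsVertex f)
      × (∃ λ f → f ∈ σ)
      × (∃ λ g → IsCommonNbr σ g)

Pred : ℕ → ℕ → Set₁
Pred n m = VSet n m → Set

-- one step of the construction, relative to the current set Q (= S'_{i-1})
-- and the vertex c = ⟨i⟩
Sstep : ∀ {n m} → Pred n m → Map n m → Pred n m
Sstep Q c σ = Q σ × σ c ≡ false × Q (σ ∪｛ c ｝)

Mstep : ∀ {n m} → Pred n m → Map n m → Pred n m
Mstep Q c σ = ∃ λ τ → Sstep Q c τ × (σ ≐ (τ ∪｛ c ｝))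

Qstep : ∀ {n m} → Pred n m → Map n m → Pred n m
Qstep Q c σ = Q σ × ¬ Sstep Q c σ × ¬ Mstep Q c σ

-- S'_i (with S'_0 = P), for 0 ≤ i ≤ m; step i (1-based) uses ⟨i⟩,
-- i.e. the constant map at the Fin-element with toℕ = i - 1
S' : ∀ {n m} (i : ℕ) → i ≤ m → Pred n m
S' zero _ = InP
S' (suc i) p = Qstep (S' i (<⇒≤ p)) ⟨ fromℕ< p ⟩

-- S_{k+1} and μ_{k+1}(S_{k+1}) for the Fin-element k (i.e. the vertex ⟨k+1⟩)
S : ∀ {n m} → Fin m → Pred n m
S k = Sstep (S' (toℕ k) (<⇒≤ (toℕ<n k))) ⟨ k ⟩

μS : ∀ {n m} → Fin m → Pred n m
μS k = Mstep (S' (toℕ k) (<⇒≤ (toℕ<n k))) ⟨ k ⟩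

Critical : ∀ {n m} → VSet n m → Set
Critical σ = InP σ × (∀ k → ¬ S k σ) × (∀ k → ¬ μS k σ)

module Submission where

-- Colours are numbered from 0, so ⟨0⟩ is the paper's ⟨1⟩; of n ≥ 3 only n ≥ 2 is used.
-- Every member f of σ avoids the colour 0, since ⟨0⟩ is a common neighbour of σ.
-- One shows by induction on j ≥ 1 that ⟨j⟩ ∈ σ and that no other member of σ uses the
-- colour j.  If ⟨j⟩ ∉ σ, then σ ∪ {⟨j⟩} survives the first j steps of the matching
-- and σ is matched upward at step j+1.  If some f ≠ ⟨j⟩ in σ uses j, then σ ∖ {⟨j⟩}
-- survives as well and σ is matched downward: a common neighbour g of
-- (σ ∖ {⟨j⟩}) ∪ {⟨0⟩}, with the colours j and 0 exchanged, is a common neighbour of σ,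
-- so it is ⟨0⟩, whence g = ⟨j⟩, which f is not adjacent to.  Both contradict criticality.
-- The survival arguments rest on one observation: a set containing the ⟨k⟩ with
-- 1 ≤ k < j, each adjacent to the rest, cannot be μ_{k+1} of anything, since removing
-- ⟨k⟩ leaves a set matched with ⟨0⟩ at step 1, with common neighbour ⟨k⟩.

open import Defs
open import Data.Nat using (ℕ; zero; suc; _≤_; _<_; s≤s)
open import Data.Nat.Properties using (<⇒≤; ≤-irrelevant; ≤-refl; <-irrefl; 0≢1+n; m≤n⇒m<n∨m≡n)
open import Data.Fin using (Fin; toℕ; fromℕ<; zero; punchIn)
open import Data.Fin.Properties using (toℕ-fromℕ<; toℕ<n; toℕ-injective; punchInᵢ≢i)
import Data.Fin.Properties as FinP
open import Data.Fin.Permutation.Components using (transpose; transpose-inverse)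
open import Data.Vec using (lookup; map)
open import Data.Vec.Properties using (≡-dec; lookup-replicate; lookup-map)
open import Data.Bool using (true; false; _∧_; not)
open import Data.Bool.Properties
  using (¬-not; not-¬; ∧-conicalˡ; ∨-conicalˡ; ∨-zeroʳ; ∨-identityʳ; ∧-zeroʳ; ∧-identityʳ)
open import Data.Empty using (⊥)
open import Data.Product using (∃; _×_; _,_; proj₁; proj₂)
open import Data.Sum using (_⊎_; inj₁; inj₂; [_,_])
open import Function using (_∘_)
open import Function.Bundles using (_⇔_; mk⇔; Equivalence)
open import Function.Definitions using (Injective)
open import Relation.Nullary using (¬_; Dec; yes; no)
open import Relation.Nullary.Decidable using (⌊_⌋; decidable-stable)
open import Relation.Nullary.Negation using (contradiction)
open import Relation.Binary.PropositionalEquality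
  using (_≡_; _≢_; refl; sym; trans; cong; subst; module ≡-Reasoning)

private
  variable
    n m : ℕ

_∉_ : Map n m → VSet n m → Set
f ∉ σ = σ f ≡ false

_⊆_ : VSet n m → VSet n m → Set
σ ⊆ τ = ∀ {f} → f ∈ σ → f ∈ τ

_∖｛_｝ : VSet n m → Map n m → VSet n m
(σ ∖｛ c ｝) f = σ f ∧ not ⌊ ≡-dec FinP._≟_ f c ⌋

∈-∪｛｝⁺ˡ : ∀ {σ : VSet n m} {c} → σ ⊆ (σ ∪｛ c ｝)
∈-∪｛｝⁺ˡ f∈σ rewrite f∈σ = refl

∈-∪｛｝⁺ʳ : ∀ (σ : VSet n m) c → c ∈ (σ ∪｛ c ｝)
∈-∪｛｝⁺ʳ σ c with ≡-dec FinP._≟_ c c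
... | yes _   = ∨-zeroʳ (σ c)
... | no c≢c = contradiction refl c≢c

∈-∪｛｝⁻ : ∀ (σ : VSet n m) {c f} → f ∈ (σ ∪｛ c ｝) → f ∈ σ ⊎ f ≡ c
∈-∪｛｝⁻ σ {c} {f} f∈ with σ f | ≡-dec FinP._≟_ f c
∈-∪｛｝⁻ σ f∈ | true  | _       = inj₁ refl
∈-∪｛｝⁻ σ f∈ | false | yes f≡c = inj₂ f≡c
∈-∪｛｝⁻ σ () | false | no _

∉-∪｛｝⁻ : ∀ (σ : VSet n m) {c f} → f ∉ (σ ∪｛ c ｝) → f ∉ σ
∉-∪｛｝⁻ σ {f = f} = ∨-conicalˡ (σ f) _

∈-∖⁻ : ∀ {σ : VSet n m} {c} → (σ ∖｛ c ｝) ⊆ σ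
∈-∖⁻ {σ = σ} {f = f} = ∧-conicalˡ (σ f) _

∈-∖⁺ : ∀ {σ : VSet n m} {c f} → f ∈ σ → f ≢ c → f ∈ (σ ∖｛ c ｝)
∈-∖⁺ {c = c} {f} f∈σ f≢c with ≡-dec FinP._≟_ f c
... | yes f≡c = contradiction f≡c f≢c
... | no _    = trans (∧-identityʳ _) f∈σ

c∉σ∖c : ∀ (σ : VSet n m) c → c ∉ (σ ∖｛ c ｝)
c∉σ∖c σ c with ≡-dec FinP._≟_ c c
... | yes _   = ∧-zeroʳ (σ c)
... | no c≢c = contradiction refl c≢c

∖-∪｛｝-inverse : ∀ {σ : VSet n m} {c} → c ∈ σ → σ ≐ ((σ ∖｛ c ｝) ∪｛ c ｝)
∖-∪｛｝-inverse {σ = σ} {c} c∈σ f with ≡-dec FinP._≟_ f c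
... | yes refl = trans c∈σ (sym (∨-zeroʳ _))
... | no _     = sym (trans (∨-identityʳ _) (∧-identityʳ (σ f)))

⟨⟩-isVertex : ∀ (x : Fin m) → IsVertex (⟨_⟩ {n} x)
⟨⟩-isVertex x = inj₁ λ i j → trans (lookup-replicate i x) (sym (lookup-replicate j x))

⟨⟩-injective : ∀ {x y : Fin m} → ⟨_⟩ {suc n} x ≡ ⟨ y ⟩ → x ≡ y
⟨⟩-injective = cong (λ v → lookup v zero)

avoid⇒adj-⟨⟩ʳ : ∀ {h : Map n m} {x} → (∀ i → lookup h i ≢ x) → Adj h ⟨ x ⟩
avoid⇒adj-⟨⟩ʳ {x = x} avoid i j _ eq = avoid i (trans eq (lookup-replicate j x))

⟨⟩-adj : ∀ {x y : Fin m} → x ≢ y → Adj (⟨_⟩ {n} x) ⟨ y ⟩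
⟨⟩-adj {x = x} x≢y = avoid⇒adj-⟨⟩ʳ {h = ⟨ x ⟩} λ i eq → x≢y (trans (sym (lookup-replicate i x)) eq)

adj-⟨⟩ʳ⇒avoid : ∀ {h : Map (suc (suc n)) m} {x} → Adj h ⟨ x ⟩ → ∀ i → lookup h i ≢ x
adj-⟨⟩ʳ⇒avoid {x = x} adj i eq =
  adj i (punchIn i zero) (punchInᵢ≢i i zero ∘ sym)
      (trans eq (sym (lookup-replicate (punchIn i zero) x)))

adj-⟨⟩ˡ⇒avoid : ∀ {g : Map (suc (suc n)) m} {x} → Adj ⟨ x ⟩ g → ∀ i → lookup g i ≢ x
adj-⟨⟩ˡ⇒avoid {x = x} adj i eq =
  adj (punchIn i zero) i (punchInᵢ≢i i zero)
      (trans (lookup-replicate (punchIn i zero) x) (sym eq))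

map-isVertex : ∀ {m′} {φ : Fin m → Fin m′} {g : Map n m} →
               Injective _≡_ _≡_ φ → IsVertex g → IsVertex (map φ g)
map-isVertex {φ = φ} {g} _ (inj₁ constant) = inj₁ λ i j → begin
  lookup (map φ g) i  ≡⟨ lookup-map i φ g ⟩
  φ (lookup g i)      ≡⟨ cong φ (constant i j) ⟩
  φ (lookup g j)      ≡⟨ lookup-map j φ g ⟨
  lookup (map φ g) j  ∎
  where open ≡-Reasoning
map-isVertex {φ = φ} {g} φ-inj (inj₂ injective) = inj₂ λ i j eq →
  injective i j (φ-inj (trans (sym (lookup-map i φ g)) (trans eq (lookup-map j φ g))))

transpose-injective : ∀ (i j : Fin m) → Injective _≡_ _≡_ (transpose i j)
transpose-injective i j {x} {y} eq = begin
  x                             ≡⟨ transpose-inverse j i ⟨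
  transpose j i (transpose i j x) ≡⟨ cong (transpose j i) eq ⟩
  transpose j i (transpose i j y) ≡⟨ transpose-inverse j i ⟩
  y                             ∎
  where open ≡-Reasoning

transpose-moves : ∀ (i j : Fin m) → transpose i j i ≡ j
transpose-moves i j with i FinP.≟ i
... | yes _   = refl
... | no i≢i = contradiction refl i≢i

transpose-fixes : ∀ {i j k : Fin m} → k ≢ i → k ≢ j → transpose i j k ≡ k
transpose-fixes {i = i} {j} {k} k≢i k≢j with k FinP.≟ i
... | yes k≡i = contradiction k≡i k≢i
... | no _ with k FinP.≟ j
...   | yes k≡j = contradiction k≡j k≢j
...   | no _    = refl

S'-cong : ∀ {i i′} → i ≡ i′ → (p : i ≤ m) (p′ : i′ ≤ m) → S' {n} i p ≡ S' i′ p′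
S'-cong refl p p′ = cong (S' _) (≤-irrelevant p p′)

S'⊆P : ∀ i (p : i ≤ m) {τ : VSet n m} → S' i p τ → InP τ
S'⊆P zero    p τ∈S' = τ∈S'
S'⊆P (suc i) p τ∈S' = S'⊆P i _ (proj₁ τ∈S')

S'⇒¬S₁ : ∀ i (p : suc i ≤ suc m) {τ : VSet n (suc m)} → S' (suc i) p τ → ¬ S zero τ
S'⇒¬S₁ zero    p τ∈S' = proj₁ (proj₂ τ∈S')
S'⇒¬S₁ (suc i) p τ∈S' = S'⇒¬S₁ i _ (proj₁ τ∈S')

critical⇒S' : ∀ {σ : VSet n m} → Critical σ → ∀ i (p : i ≤ m) → S' i p σ
critical⇒S' (σ∈P , _) zero p = σ∈P
critical⇒S' {σ = σ} crit@(_ , ∉S , ∉μS) (suc i) p =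
  critical⇒S' crit i _ , ∉S k ∘ subst (λ Q → Sstep Q ⟨ k ⟩ σ) S'≡
                       , ∉μS k ∘ subst (λ Q → Mstep Q ⟨ k ⟩ σ) S'≡
  where
  k = fromℕ< p
  S'≡ : S' i (<⇒≤ p) ≡ S' (toℕ k) (<⇒≤ (toℕ<n k))
  S'≡ = S'-cong (sym (toℕ-fromℕ< p)) _ _

record Unmatched (j : ℕ) (τ : VSet n (suc m)) : Set where
  field
    inP       : InP τ
    ⟨0⟩∉      : ⟨ zero ⟩ ∉ τ
    ¬inP-∪⟨0⟩ : ¬ InP (τ ∪｛ ⟨ zero ⟩ ｝)
    ⟨k⟩∈      : ∀ k → k ≢ zero → toℕ k < j → ⟨ k ⟩ ∈ τ
    adj-⟨k⟩   : ∀ k → k ≢ zero → toℕ k < j → ∀ h → h ∈ τ → h ≢ ⟨ k ⟩ → Adj h ⟨ k ⟩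

  ⊆-∪⟨0⟩∈P : ∀ {k ρ} → k ≢ zero → toℕ k < j → ρ ⊆ τ → ⟨ k ⟩ ∉ ρ → InP (ρ ∪｛ ⟨ zero ⟩ ｝)
  ⊆-∪⟨0⟩∈P {k} {ρ} k≢0 k<j ρ⊆τ ⟨k⟩∉ρ =
    vertex , (⟨ zero ⟩ , ∈-∪｛｝⁺ʳ ρ _) , ⟨ k ⟩ , ⟨⟩-isVertex k , adj-⟨k⟩-∪⟨0⟩
    where
    vertex : ∀ h → h ∈ (ρ ∪｛ ⟨ zero ⟩ ｝) → IsVertex h
    vertex h h∈ = [ proj₁ inP h ∘ ρ⊆τ , (λ { refl → ⟨⟩-isVertex zero }) ] (∈-∪｛｝⁻ ρ h∈)
    adj-⟨k⟩-∪⟨0⟩ : ∀ h → h ∈ (ρ ∪｛ ⟨ zero ⟩ ｝) → Adj h ⟨ k ⟩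
    adj-⟨k⟩-∪⟨0⟩ h h∈ =
      [ (λ h∈ρ → adj-⟨k⟩ k k≢0 k<j h (ρ⊆τ h∈ρ) λ { refl → not-¬ h∈ρ ⟨k⟩∉ρ })
      , (λ { refl → ⟨⟩-adj (k≢0 ∘ sym) }) ] (∈-∪｛｝⁻ ρ h∈)

Unmatched⇒S' : ∀ {j} {τ : VSet n (suc m)} → Unmatched j τ → ∀ i (p : i ≤ suc m) → i ≤ j → S' i p τ
Unmatched⇒S' U zero p _ = Unmatched.inP U
Unmatched⇒S' {τ = τ} U (suc zero) p _ = inP , ¬inP-∪⟨0⟩ ∘ proj₂ ∘ proj₂ , not-μ₁
  where
  open Unmatched U
  not-μ₁ : ¬ Mstep InP ⟨ zero ⟩ τ
  not-μ₁ (ρ , _ , τ≐) = not-¬ (trans (τ≐ ⟨ zero ⟩) (∈-∪｛｝⁺ʳ ρ _)) ⟨0⟩∉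
Unmatched⇒S' {j = j} {τ} U (suc (suc i)) p i+2≤j =
  Unmatched⇒S' U (suc i) _ (<⇒≤ i+2≤j) , not-S , not-μS
  where
  open Unmatched U
  k = fromℕ< p
  k≢0 : k ≢ zero
  k≢0 k≡0 = 0≢1+n (trans (cong toℕ (sym k≡0)) (toℕ-fromℕ< p))
  k<j : toℕ k < j
  k<j = subst (_< j) (sym (toℕ-fromℕ< p)) i+2≤j
  not-S : ¬ Sstep (S' (suc i) (<⇒≤ p)) ⟨ k ⟩ τ
  not-S (_ , ⟨k⟩∉τ , _) = not-¬ (⟨k⟩∈ k k≢0 k<j) ⟨k⟩∉τ
  not-μS : ¬ Mstep (S' (suc i) (<⇒≤ p)) ⟨ k ⟩ τ
  not-μS (ρ , (ρ∈S' , ⟨k⟩∉ρ , _) , τ≐) =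
    S'⇒¬S₁ i _ ρ∈S' (S'⊆P (suc i) _ ρ∈S' , ⟨0⟩∉ρ , ⊆-∪⟨0⟩∈P k≢0 k<j ρ⊆τ ⟨k⟩∉ρ)
    where
    ρ⊆τ : ρ ⊆ τ
    ρ⊆τ {h} h∈ρ = trans (τ≐ h) (∈-∪｛｝⁺ˡ {σ = ρ} h∈ρ)
    ⟨0⟩∉ρ : ⟨ zero ⟩ ∉ ρ
    ⟨0⟩∉ρ = ∉-∪｛｝⁻ ρ (trans (sym (τ≐ ⟨ zero ⟩)) ⟨0⟩∉)

module CriticalCell
  (σ : VSet (suc (suc n)) (suc m)) (crit : Critical σ)
  (⟨0⟩∈N : IsCommonNbr σ ⟨ zero ⟩) (N⊆⟨0⟩ : ∀ {g} → IsCommonNbr σ g → g ≡ ⟨ zero ⟩)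
  where

  σ-avoids-0 : ∀ {f} → f ∈ σ → ∀ i → lookup f i ≢ zero
  σ-avoids-0 {f} f∈σ = adj-⟨⟩ʳ⇒avoid {h = f} (proj₂ ⟨0⟩∈N f f∈σ)

  ⟨0⟩∉σ : ⟨ zero ⟩ ∉ σ
  ⟨0⟩∉σ = ¬-not λ ⟨0⟩∈σ → σ-avoids-0 ⟨0⟩∈σ zero refl

  ⊇σ-with-⟨0⟩-∉P : ∀ {τ} → σ ⊆ τ → ⟨ zero ⟩ ∈ τ → ¬ InP τ
  ⊇σ-with-⟨0⟩-∉P σ⊆τ ⟨0⟩∈τ (_ , _ , g , g-vertex , g-adj) =
    adj-⟨⟩ʳ⇒avoid {h = ⟨ zero ⟩} (subst (Adj ⟨ zero ⟩) g≡⟨0⟩ (g-adj ⟨ zero ⟩ ⟨0⟩∈τ)) zero refl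
    where
    g≡⟨0⟩ : g ≡ ⟨ zero ⟩
    g≡⟨0⟩ = N⊆⟨0⟩ (g-vertex , λ f f∈σ → g-adj f (σ⊆τ f∈σ))

  recolour-commonNbr : ∀ {j g} → IsCommonNbr ((σ ∖｛ ⟨ j ⟩ ｝) ∪｛ ⟨ zero ⟩ ｝) g
                     → IsCommonNbr σ (map (transpose j zero) g)
  recolour-commonNbr {j} {g} (g-vertex , g-adj) =
    map-isVertex {g = g} (transpose-injective j zero) g-vertex , g′-adj
    where
    g-avoids-0 : ∀ b → lookup g b ≢ zero
    g-avoids-0 = adj-⟨⟩ˡ⇒avoid {g = g} (g-adj ⟨ zero ⟩ (∈-∪｛｝⁺ʳ (σ ∖｛ ⟨ j ⟩ ｝) _))
    g′-adj : ∀ h → h ∈ σ → Adj h (map (transpose j zero) g)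
    g′-adj h h∈σ i b i≢b hi≡g′b = by-cases (lookup g b FinP.≟ j) (≡-dec FinP._≟_ h ⟨ j ⟩)
      where
      hi≡tgb : lookup h i ≡ transpose j zero (lookup g b)
      hi≡tgb = trans hi≡g′b (lookup-map b (transpose j zero) g)
      hi≡gb : lookup g b ≢ j → lookup h i ≡ lookup g b
      hi≡gb gb≢j = trans hi≡tgb (transpose-fixes gb≢j (g-avoids-0 b))
      by-cases : Dec (lookup g b ≡ j) → Dec (h ≡ ⟨ j ⟩) → ⊥
      by-cases (yes gb≡j) _ =
        σ-avoids-0 h∈σ i (trans hi≡tgb (trans (cong (transpose j zero) gb≡j) (transpose-moves j zero)))
      by-cases (no gb≢j) (yes h≡⟨j⟩) =
        gb≢j (trans (sym (hi≡gb gb≢j)) (trans (cong (λ v → lookup v i) h≡⟨j⟩) (lookup-replicate i j)))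
      by-cases (no gb≢j) (no h≢⟨j⟩) =
        g-adj h (∈-∪｛｝⁺ˡ {σ = σ ∖｛ ⟨ j ⟩ ｝} (∈-∖⁺ {σ = σ} h∈σ h≢⟨j⟩)) i b i≢b (hi≡gb gb≢j)

  removal-∪⟨0⟩∉P : ∀ {j f} → f ∈ σ → f ≢ ⟨ j ⟩ → ∀ a → lookup f a ≡ j
                  → ¬ InP ((σ ∖｛ ⟨ j ⟩ ｝) ∪｛ ⟨ zero ⟩ ｝)
  removal-∪⟨0⟩∉P {j} {f} f∈σ f≢⟨j⟩ a fa≡j (_ , _ , g , g∈N) =
    proj₂ g∈N f (∈-∪｛｝⁺ˡ {σ = σ ∖｛ ⟨ j ⟩ ｝} (∈-∖⁺ {σ = σ} f∈σ f≢⟨j⟩))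
      a b (punchInᵢ≢i a zero ∘ sym) (trans fa≡j (sym g-takes-j))
    where
    b = punchIn a zero
    t = transpose j zero
    g-takes-j : lookup g b ≡ j
    g-takes-j = transpose-injective j zero (begin
      t (lookup g b)            ≡⟨ lookup-map b t g ⟨
      lookup (map t g) b        ≡⟨ cong (λ v → lookup v b) (N⊆⟨0⟩ {map t g} (recolour-commonNbr {j} {g} g∈N)) ⟩
      lookup ⟨ zero ⟩ b         ≡⟨ lookup-replicate b zero ⟩
      zero                      ≡⟨ transpose-moves j zero ⟨
      t j                       ∎)
      where open ≡-Reasoning

  Exclusive : Fin (suc m) → Set
  Exclusive k = ⟨ k ⟩ ∈ σ × (∀ h → h ∈ σ → h ≢ ⟨ k ⟩ → Adj h ⟨ k ⟩)

  ExclusiveBelow : ℕ → Set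
  ExclusiveBelow j = ∀ k → k ≢ zero → toℕ k < j → Exclusive k

  unmatched-between : ∀ {j τ} → j ≢ zero → ExclusiveBelow (toℕ j)
                    → σ ⊆ τ → τ ⊆ (σ ∪｛ ⟨ j ⟩ ｝) → ⟨ j ⟩ ∈ τ → Unmatched (toℕ j) τ
  unmatched-between {j} {τ} j≢0 below σ⊆τ τ⊆σ∪⟨j⟩ ⟨j⟩∈τ = record
    { inP       = vertex , (⟨ j ⟩ , ⟨j⟩∈τ) , ⟨ zero ⟩ , ⟨⟩-isVertex zero , adj-⟨0⟩
    ; ⟨0⟩∉      = ¬-not λ ⟨0⟩∈τ →
        [ (λ ⟨0⟩∈σ → not-¬ ⟨0⟩∈σ ⟨0⟩∉σ) , j≢0 ∘ sym ∘ ⟨⟩-injective ] (split ⟨0⟩∈τ)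
    ; ¬inP-∪⟨0⟩ = ⊇σ-with-⟨0⟩-∉P (λ f∈σ → ∈-∪｛｝⁺ˡ {σ = τ} (σ⊆τ f∈σ)) (∈-∪｛｝⁺ʳ τ _)
    ; ⟨k⟩∈      = λ k k≢0 k<j → σ⊆τ (proj₁ (below k k≢0 k<j))
    ; adj-⟨k⟩   = λ k k≢0 k<j h h∈τ h≢⟨k⟩ →
        [ (λ h∈σ → proj₂ (below k k≢0 k<j) h h∈σ h≢⟨k⟩)
        , (λ { refl → ⟨⟩-adj λ j≡k → <-irrefl (cong toℕ (sym j≡k)) k<j }) ] (split h∈τ)
    }
    where
    split : ∀ {h} → h ∈ τ → h ∈ σ ⊎ h ≡ ⟨ j ⟩
    split h∈τ = ∈-∪｛｝⁻ σ (τ⊆σ∪⟨j⟩ h∈τ)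
    vertex : ∀ h → h ∈ τ → IsVertex h
    vertex h h∈τ = [ proj₁ (proj₁ crit) h , (λ { refl → ⟨⟩-isVertex j }) ] (split h∈τ)
    adj-⟨0⟩ : ∀ h → h ∈ τ → Adj h ⟨ zero ⟩
    adj-⟨0⟩ h h∈τ = [ proj₂ ⟨0⟩∈N h , (λ { refl → ⟨⟩-adj j≢0 }) ] (split h∈τ)

  removal-unmatched : ∀ {j f} → ExclusiveBelow (toℕ j) → f ∈ σ → f ≢ ⟨ j ⟩
                    → ∀ a → lookup f a ≡ j → Unmatched (toℕ j) (σ ∖｛ ⟨ j ⟩ ｝)
  removal-unmatched {j} {f} below f∈σ f≢⟨j⟩ a fa≡j = record
    { inP       = (λ h → proj₁ (proj₁ crit) h ∘ σ∖⟨j⟩⊆σ) , (f , ∈-∖⁺ {σ = σ} f∈σ f≢⟨j⟩)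
                , ⟨ zero ⟩ , proj₁ ⟨0⟩∈N , (λ h → proj₂ ⟨0⟩∈N h ∘ σ∖⟨j⟩⊆σ)
    ; ⟨0⟩∉      = ¬-not λ ⟨0⟩∈ → not-¬ (σ∖⟨j⟩⊆σ ⟨0⟩∈) ⟨0⟩∉σ
    ; ¬inP-∪⟨0⟩ = removal-∪⟨0⟩∉P f∈σ f≢⟨j⟩ a fa≡j
    ; ⟨k⟩∈      = λ k k≢0 k<j → ∈-∖⁺ {σ = σ} (proj₁ (below k k≢0 k<j))
                    λ ⟨k⟩≡⟨j⟩ → <-irrefl (cong toℕ (⟨⟩-injective ⟨k⟩≡⟨j⟩)) k<j
    ; adj-⟨k⟩   = λ k k≢0 k<j h → proj₂ (below k k≢0 k<j) h ∘ σ∖⟨j⟩⊆σ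
    }
    where
    σ∖⟨j⟩⊆σ : (σ ∖｛ ⟨ j ⟩ ｝) ⊆ σ
    σ∖⟨j⟩⊆σ = ∈-∖⁻ {σ = σ}

  ⟨⟩∈σ : ∀ {j} → j ≢ zero → ExclusiveBelow (toℕ j) → ⟨ j ⟩ ∈ σ
  ⟨⟩∈σ {j} j≢0 below = ¬-not λ ⟨j⟩∉σ →
    proj₁ (proj₂ crit) j (critical⇒S' crit (toℕ j) _ , ⟨j⟩∉σ , Unmatched⇒S' σ∪⟨j⟩-unmatched (toℕ j) _ ≤-refl)
    where
    σ∪⟨j⟩-unmatched : Unmatched (toℕ j) (σ ∪｛ ⟨ j ⟩ ｝)
    σ∪⟨j⟩-unmatched = unmatched-between j≢0 below (∈-∪｛｝⁺ˡ {σ = σ}) (λ h∈ → h∈) (∈-∪｛｝⁺ʳ σ _)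

  exclusive-step : ∀ {j} → j ≢ zero → ExclusiveBelow (toℕ j) → Exclusive j
  exclusive-step {j} j≢0 below = ⟨j⟩∈σ , λ h h∈σ h≢⟨j⟩ → avoid⇒adj-⟨⟩ʳ {h = h} (avoids-j h∈σ h≢⟨j⟩)
    where
    ⟨j⟩∈σ : ⟨ j ⟩ ∈ σ
    ⟨j⟩∈σ = ⟨⟩∈σ j≢0 below
    σ≐ : σ ≐ ((σ ∖｛ ⟨ j ⟩ ｝) ∪｛ ⟨ j ⟩ ｝)
    σ≐ = ∖-∪｛｝-inverse ⟨j⟩∈σ
    restored-unmatched : Unmatched (toℕ j) ((σ ∖｛ ⟨ j ⟩ ｝) ∪｛ ⟨ j ⟩ ｝)
    restored-unmatched = unmatched-between j≢0 below
      (λ {h} h∈σ → trans (sym (σ≐ h)) h∈σ) (λ {h} h∈ → ∈-∪｛｝⁺ˡ {σ = σ} (trans (σ≐ h) h∈))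
      (∈-∪｛｝⁺ʳ (σ ∖｛ ⟨ j ⟩ ｝) ⟨ j ⟩)
    avoids-j : ∀ {h} → h ∈ σ → h ≢ ⟨ j ⟩ → ∀ a → lookup h a ≢ j
    avoids-j h∈σ h≢⟨j⟩ a ha≡j = proj₂ (proj₂ crit) j (σ ∖｛ ⟨ j ⟩ ｝ , σ∖⟨j⟩∈S , σ≐)
      where
      σ∖⟨j⟩∈S : S j (σ ∖｛ ⟨ j ⟩ ｝)
      σ∖⟨j⟩∈S = Unmatched⇒S' (removal-unmatched below h∈σ h≢⟨j⟩ a ha≡j) (toℕ j) _ ≤-refl
              , c∉σ∖c σ ⟨ j ⟩ , Unmatched⇒S' restored-unmatched (toℕ j) _ ≤-refl

  exclusiveBelow : ∀ t → ExclusiveBelow t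
  exclusiveBelow zero    _ _   ()
  exclusiveBelow (suc t) k k≢0 (s≤s k≤t) with m≤n⇒m<n∨m≡n k≤t
  ... | inj₁ k<t = exclusiveBelow t k k≢0 k<t
  ... | inj₂ k≡t = exclusive-step k≢0 (subst ExclusiveBelow (sym k≡t) (exclusiveBelow t))

  exclusive : ∀ k → k ≢ zero → Exclusive k
  exclusive k k≢0 = exclusiveBelow (suc (toℕ k)) k k≢0 ≤-refl

  member⇒constant : ∀ {f} → f ∈ σ → f ≡ ⟨ lookup f zero ⟩
  member⇒constant {f} f∈σ = decidable-stable (≡-dec FinP._≟_ f _) λ f≢⟨f0⟩ →
    adj-⟨⟩ʳ⇒avoid {h = f} (proj₂ (exclusive (lookup f zero) (σ-avoids-0 f∈σ zero)) f f∈σ f≢⟨f0⟩) zero refl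

lemma4p9 : (m n : ℕ) → 3 ≤ n → n < m → (σ : VSet n m) → Critical σ
    → (∀ g → IsCommonNbr σ g ⇔ (∃ λ (k : Fin m) → toℕ k ≡ 0 × g ≡ ⟨ k ⟩))
    → ∀ f → f ∈ σ ⇔ (∃ λ (k : Fin m) → toℕ k ≢ 0 × f ≡ ⟨ k ⟩)
lemma4p9 _ 1 (s≤s ()) _ _ _ _ _
lemma4p9 (suc m) (suc (suc n)) _ _ σ crit N≡｛⟨0⟩｝ f = mk⇔ to from
  where
  ⟨0⟩∈N : IsCommonNbr σ ⟨ zero ⟩
  ⟨0⟩∈N = Equivalence.from (N≡｛⟨0⟩｝ ⟨ zero ⟩) (zero , refl , refl)

  N⊆⟨0⟩ : ∀ {g} → IsCommonNbr σ g → g ≡ ⟨ zero ⟩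
  N⊆⟨0⟩ {g} g∈N with k , k≡0 , refl ← Equivalence.to (N≡｛⟨0⟩｝ g) g∈N = cong ⟨_⟩ (toℕ-injective k≡0)

  open CriticalCell σ crit ⟨0⟩∈N N⊆⟨0⟩

  to : f ∈ σ → ∃ λ k → toℕ k ≢ 0 × f ≡ ⟨ k ⟩
  to f∈σ = lookup f zero , σ-avoids-0 f∈σ zero ∘ toℕ-injective , member⇒constant f∈σ

  from : (∃ λ k → toℕ k ≢ 0 × f ≡ ⟨ k ⟩) → f ∈ σ
  from (k , k≢0 , refl) = proj₁ (exclusive k (k≢0 ∘ cong toℕ))
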